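{- For all integers $k\ge0$ and $n\ge k+1$, \[ f_{112,221}(n,k)=\sum_{j=1}^{k} j\cdot j!\binom{k}{j}; \] for all integers $k\ge n\ge 2$, \[ f_{112,221}(n,k)=n!\binom{k}{n}+\sum_{j=1}^{n-1} j\cdot j!\binom{k}{j}; \] and $f_{112,221}(0,k)=1$, $f_{112,221}(1,k)=k$.
   Context: For integers $k,n\ge 0$, a word is an element of $[k]^n$, where $[k]=\{1,\dots,k\}$ is totally ordered. A pattern is a word $\tau\in[\ell]^m$ containing every letter $1,\dots,\ell$. A word $\sigma\in[k]^n$ contains $\tau$ if there are indices $1\le i_1<\dots<i_m\le n$ such that for all $1\le a,b\le m$ and each relation $\phi\in\{<,=,>\}$, $\sigma(i_a)\,\phi\,\sigma(i_b)$ holds iff $\tau(a)\,\phi\,\tau(b)$ holds; otherwise $\sigma$ avoids $\tau$. $f_{112,221}(n,k)$ is the number of words in $[k]^n$ that avoid both $112$ and $221$. -}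

module Defs where

open import Data.Nat.Base using (ℕ; zero; suc; _+_; _*_; _≡ᵇ_; _<ᵇ_; _!)
open import Data.Nat.Combinatorics using (_C_)
open import Data.Bool.Base using (Bool; true; false; _∧_; not; if_then_else_)
open import Data.List.Base using (List; []; _∷_; map; concatMap; length; filterᵇ; upTo; zip)
open import Data.Bool.ListAction using (any; all)
open import Data.Nat.ListAction using (sum)
open import Data.Product.Base using (_,_)

letters : ℕ → List ℕ
letters k = map suc (upTo k)

words : ℕ → ℕ → List (List ℕ)
words zero    k = [] ∷ []
words (suc n) k = concatMap (λ w → map (λ a → a ∷ w) (letters k)) (words n k)

data Rel : Set where
  lt eq gt : Rel

rel : ℕ → ℕ → Rel
rel x y = if x <ᵇ y then lt else (if x ≡ᵇ y then eq else gt)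

_==R_ : Rel → Rel → Bool
lt ==R lt = true
eq ==R eq = true
gt ==R gt = true
_  ==R _  = false

-- Two lists of the same length are order-isomorphic: for all positions a < b,
-- the relation between entries a and b is the same in both lists
-- (pairs with a = b and pairs with a > b then agree automatically).
orderIso : List ℕ → List ℕ → Bool
orderIso []       []       = true
orderIso (x ∷ xs) (y ∷ ys) =
  all (λ { (x' , y') → rel x x' ==R rel y y' }) (zip xs ys) ∧ orderIso xs ys
orderIso _        _        = false

subseqs : List ℕ → List (List ℕ)
subseqs []       = [] ∷ []
subseqs (x ∷ xs) = map (x ∷_) (subseqs xs) Data.List.Base.++ subseqs xs

contains : List ℕ → List ℕ → Bool
contains σ τ = any (λ s → orderIso s τ) (subseqs σ)

avoids : List ℕ → List ℕ → Bool
avoids σ τ = not (contains σ τ)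

p112 : List ℕ
p112 = 1 ∷ 1 ∷ 2 ∷ []

p221 : List ℕ
p221 = 2 ∷ 2 ∷ 1 ∷ []

f112-221 : ℕ → ℕ → ℕ
f112-221 n k = length (filterᵇ (λ σ → avoids σ p112 ∧ avoids σ p221) (words n k))

S : ℕ → ℕ → ℕ
S m k = sum (map (λ j → j * (j !) * (k C j)) (map suc (upTo m)))

open import Relation.Binary.PropositionalEquality using (_≡_; refl)
_ : f112-221 3 2 ≡ S 2 2
_ = refl
_ : f112-221 3 4 ≡ 3 ! * (4 C 3) + S 2 4
_ = refl
_ : f112-221 2 3 ≡ 2 ! * (3 C 2) + S 1 3
_ = refl

-- A word avoids 112 and 221 iff no repeated letter is later followed by a different
-- letter, i.e. it is a word of distinct letters followed by a run of one of them.
-- Words are built by prepending letters, and whether a new first letter a keeps the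
-- word admissible, and what the result looks like, depends only on the state (d, c)
-- of the old word: its number d of distinct letters, and whether its last letter
-- may be prepended (c = lastRepeatable). A fresh letter (k ∸ d choices) is always
-- admissible and keeps c; a repeated letter is admissible only if it is the last
-- letter and c holds, and then the new flag records whether d = 1. Hence sums of a
-- function of the state over admissible words obey a linear recursion (step), whose
-- solution (closedForm) says that among admissible words of length m + 1 there are
-- k P′ d with state (d, true) for d ≤ m + 1 and (d ∸ 1) * k P′ d with state
-- (d, false) for d ≤ m. Counting gives f(n, k) = k P′ n + Σ_{d<n} d * k P′ d, and
-- d ! * C(k, d) = k P′ d vanishes for d > k.

module Submission where

open import Defs
open import Algebra.Bundles using (CommutativeMonoid)
import Algebra.Properties.CommutativeSemigroup as CommSemigroupProperties
open import Data.Bool.Base using (Bool; true; false; _∧_; _∨_; not; if_then_else_; T)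
open import Data.Bool.ListAction using (any; or)
open import Data.Bool.Properties
  using (∧-zeroʳ; ∧-identityʳ; ∨-identityʳ; ∨-zeroʳ; ∨-conicalˡ; ∨-conicalʳ; ∨-assoc; ∨-commutativeMonoid; if-∧)
open import Data.Empty using (⊥-elim)
open import Data.List.Base using (List; []; _∷_; _++_; map; length; null; filterᵇ; upTo; concatMap)
open import Data.List.Properties using (map-∘; map-cong; map-cong-local; map-++; upTo-∷ʳ)
open import Data.List.Relation.Unary.All using (All; []; _∷_)
import Data.List.Relation.Unary.All as All
import Data.List.Relation.Unary.All.Properties as All
open import Data.Nat.Base
open import Data.Nat.Combinatorics using (_C_; nCk+nC[k+1]≡[n+1]C[k+1])
open import Data.Nat.Combinatorics.Base using (_P′_)
open import Data.Nat.ListAction using (sum)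
open import Data.Nat.ListAction.Properties using (sum-++)
open import Data.Nat.Properties
open import Data.Nat.Solver using (module +-*-Solver)
open import Data.Product.Base using (_×_; _,_; proj₁; proj₂)
open import Data.Sum.Base using (inj₁; inj₂)
open import Data.Unit.Base using (tt)
open import Function.Base using (_∘_; case_of_)
open import Relation.Binary.PropositionalEquality
open import Relation.Nullary using (yes; no)

module ∨-Properties = CommSemigroupProperties (CommutativeMonoid.commutativeSemigroup ∨-commutativeMonoid)
module +-Properties = CommSemigroupProperties +-commutativeSemigroup
module *-Properties = CommSemigroupProperties *-commutativeSemigroup
open +-*-Solver using (solve; _:=_; _:+_; _:*_; con)

≡ᵇ-refl : ∀ n → (n ≡ᵇ n) ≡ true
≡ᵇ-refl zero    = refl
≡ᵇ-refl (suc n) = ≡ᵇ-refl n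

≡ᵇ-sound : ∀ m n → (m ≡ᵇ n) ≡ true → m ≡ n
≡ᵇ-sound m n m≡ᵇn = ≡ᵇ⇒≡ m n (subst T (sym m≡ᵇn) tt)

≢⇒≡ᵇ-false : ∀ {m n} → m ≢ n → (m ≡ᵇ n) ≡ false
≢⇒≡ᵇ-false {m} {n} m≢n with m ≡ᵇ n in e
... | false = refl
... | true  = ⊥-elim (m≢n (≡ᵇ-sound m n e))

≡ᵇ0-pos : ∀ {n} → 1 ≤ n → (n ≡ᵇ 0) ≡ false
≡ᵇ0-pos (s≤s _) = refl

≡ᵇ1-two : ∀ {n} → 2 ≤ n → (n ≡ᵇ 1) ≡ false
≡ᵇ1-two (s≤s (s≤s _)) = refl

any-++ : ∀ {A : Set} (p : A → Bool) xs ys → any p (xs ++ ys) ≡ any p xs ∨ any p ys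
any-++ p []       ys = refl
any-++ p (x ∷ xs) ys = trans (cong (p x ∨_) (any-++ p xs ys)) (sym (∨-assoc (p x) _ _))

any-map : ∀ {A B : Set} (p : B → Bool) (f : A → B) xs → any p (map f xs) ≡ any (p ∘ f) xs
any-map p f xs = cong or (sym (map-∘ xs))

any-cong : ∀ {A : Set} {p q : A → Bool} → (∀ x → p x ≡ q x) → ∀ xs → any p xs ≡ any q xs
any-cong p≗q xs = cong or (map-cong p≗q xs)

any-const-false : ∀ {A : Set} (xs : List A) → any (λ _ → false) xs ≡ false
any-const-false []       = refl
any-const-false (_ ∷ xs) = any-const-false xs

any-∧ˡ : ∀ {A : Set} b (p : A → Bool) xs → any (λ x → b ∧ p x) xs ≡ b ∧ any p xs
any-∧ˡ true  p xs = refl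
any-∧ˡ false p xs = any-const-false xs

any-∨ : ∀ {A : Set} (p q : A → Bool) xs → any (λ x → p x ∨ q x) xs ≡ any p xs ∨ any q xs
any-∨ p q []       = refl
any-∨ p q (x ∷ xs) = trans (cong ((p x ∨ q x) ∨_) (any-∨ p q xs)) (∨-Properties.interchange (p x) (q x) _ _)

any-subseqs-∷ : ∀ (p : List ℕ → Bool) a w →
                any p (subseqs (a ∷ w)) ≡ any (p ∘ (a ∷_)) (subseqs w) ∨ any p (subseqs w)
any-subseqs-∷ p a w = trans (any-++ p (map (a ∷_) (subseqs w)) (subseqs w))
                            (cong (_∨ any p (subseqs w)) (any-map p (a ∷_) (subseqs w)))

any-null-subseqs : ∀ w → any null (subseqs w) ≡ true
any-null-subseqs []      = refl
any-null-subseqs (c ∷ w) = trans (any-subseqs-∷ null c w)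
  (trans (cong (_∨ any null (subseqs w)) (any-const-false (subseqs w))) (any-null-subseqs w))

isSingleton : (ℕ → Bool) → List ℕ → Bool
isSingleton q []      = false
isSingleton q (c ∷ s) = q c ∧ null s

isPair : (ℕ → ℕ → Bool) → List ℕ → Bool
isPair g []      = false
isPair g (b ∷ s) = isSingleton (g b) s

anyPair : (ℕ → ℕ → Bool) → List ℕ → Bool
anyPair g []      = false
anyPair g (b ∷ w) = any (g b) w ∨ anyPair g w

any-subseqs-isSingleton : ∀ q w → any (isSingleton q) (subseqs w) ≡ any q w
any-subseqs-isSingleton q []      = refl
any-subseqs-isSingleton q (c ∷ w) = trans (any-subseqs-∷ (isSingleton q) c w)
  (cong₂ _∨_ (trans (any-∧ˡ (q c) null (subseqs w)) (trans (cong (q c ∧_) (any-null-subseqs w)) (∧-identityʳ (q c))))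
             (any-subseqs-isSingleton q w))

any-subseqs-isPair : ∀ g w → any (isPair g) (subseqs w) ≡ anyPair g w
any-subseqs-isPair g []      = refl
any-subseqs-isPair g (b ∷ w) = trans (any-subseqs-∷ (isPair g) b w)
  (cong₂ _∨_ (any-subseqs-isSingleton (g b) w) (any-subseqs-isPair g w))

anyPair-∨ : ∀ g h w → anyPair g w ∨ anyPair h w ≡ anyPair (λ b c → g b c ∨ h b c) w
anyPair-∨ g h []      = refl
anyPair-∨ g h (b ∷ w) = trans (∨-Properties.interchange (any (g b) w) (anyPair g w) (any (h b) w) (anyPair h w))
  (cong₂ _∨_ (sym (any-∨ (g b) (h b) w)) (anyPair-∨ g h w))

anyPair-cong : ∀ {g h} → (∀ b c → g b c ≡ h b c) → ∀ w → anyPair g w ≡ anyPair h w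
anyPair-cong g≗h []      = refl
anyPair-cong g≗h (b ∷ w) = cong₂ _∨_ (any-cong (g≗h b) w) (anyPair-cong g≗h w)

-- Occurrences of 112 and 221 starting at the first letter

orderIso-length : ∀ xs ys → length xs ≢ length ys → orderIso xs ys ≡ false
orderIso-length []       []       ≢ = ⊥-elim (≢ refl)
orderIso-length []       (_ ∷ _)  _ = refl
orderIso-length (_ ∷ _)  []       _ = refl
orderIso-length (x ∷ xs) (y ∷ ys) ≢
  rewrite orderIso-length xs ys (≢ ∘ cong suc) = ∧-zeroʳ _

orderIso-∷-length3 : ∀ {x y z} a s →
                     orderIso (a ∷ s) (x ∷ y ∷ z ∷ [])
                     ≡ isPair (λ b c → orderIso (a ∷ b ∷ c ∷ []) (x ∷ y ∷ z ∷ [])) s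
orderIso-∷-length3 {x} {y} {z} a []               = orderIso-length (a ∷ []) (x ∷ y ∷ z ∷ []) (λ ())
orderIso-∷-length3 {x} {y} {z} a (b ∷ [])         = orderIso-length (a ∷ b ∷ []) (x ∷ y ∷ z ∷ []) (λ ())
orderIso-∷-length3 {x} {y} {z} a (b ∷ c ∷ [])     = sym (∧-identityʳ _)
orderIso-∷-length3 {x} {y} {z} a (b ∷ c ∷ d ∷ s) =
  trans (orderIso-length (a ∷ b ∷ c ∷ d ∷ s) (x ∷ y ∷ z ∷ []) (λ ()))
        (sym (∧-zeroʳ (orderIso (a ∷ b ∷ c ∷ []) (x ∷ y ∷ z ∷ []))))

rel-refl : ∀ a → rel a a ≡ eq
rel-refl zero    = refl
rel-refl (suc a) = rel-refl a

rel-eq≡≡ᵇ : ∀ a c → (rel a c ==R eq) ≡ (a ≡ᵇ c)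
rel-eq≡≡ᵇ zero    zero    = refl
rel-eq≡≡ᵇ zero    (suc c) = refl
rel-eq≡≡ᵇ (suc a) zero    = refl
rel-eq≡≡ᵇ (suc a) (suc c) = rel-eq≡≡ᵇ a c

rel≡⇒≡ᵇ : ∀ {a c r} → rel a c ≡ r → (a ≡ᵇ c) ≡ (r ==R eq)
rel≡⇒≡ᵇ {a} {c} e = trans (sym (rel-eq≡≡ᵇ a c)) (cong (_==R eq) e)

head-112-221 : ℕ → ℕ → ℕ → Bool
head-112-221 a b c = orderIso (a ∷ b ∷ c ∷ []) p112 ∨ orderIso (a ∷ b ∷ c ∷ []) p221

head-112-221-repeated : ∀ a c → head-112-221 a a c ≡ not (a ≡ᵇ c)
head-112-221-repeated a c rewrite rel-refl a with rel a c in e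
... | lt = sym (cong not (rel≡⇒≡ᵇ {a} {c} e))
... | eq = sym (cong not (rel≡⇒≡ᵇ {a} {c} e))
... | gt = sym (cong not (rel≡⇒≡ᵇ {a} {c} e))

head-112-221-distinct : ∀ a b c → a ≢ b → head-112-221 a b c ≡ false
head-112-221-distinct a b c a≢b with rel a b in e
... | lt = refl
... | gt = refl
... | eq = ⊥-elim (a≢b (≡ᵇ-sound a b (rel≡⇒≡ᵇ {a} {b} e)))

head-112-221≡ : ∀ a b c → head-112-221 a b c ≡ (a ≡ᵇ b) ∧ not (a ≡ᵇ c)
head-112-221≡ a b c with a ≟ b
... | yes refl = trans (head-112-221-repeated a c) (sym (cong (_∧ not (a ≡ᵇ c)) (≡ᵇ-refl a)))
... | no a≢b   = trans (head-112-221-distinct a b c a≢b) (sym (cong (_∧ not (a ≡ᵇ c)) (≢⇒≡ᵇ-false a≢b)))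

createsPattern : ℕ → List ℕ → Bool
createsPattern a []      = false
createsPattern a (b ∷ w) = ((a ≡ᵇ b) ∧ any (λ c → not (a ≡ᵇ c)) w) ∨ createsPattern a w

anyPair≡createsPattern : ∀ a w → anyPair (λ b c → (a ≡ᵇ b) ∧ not (a ≡ᵇ c)) w ≡ createsPattern a w
anyPair≡createsPattern a []      = refl
anyPair≡createsPattern a (b ∷ w) =
  cong₂ _∨_ (any-∧ˡ (a ≡ᵇ b) (λ c → not (a ≡ᵇ c)) w) (anyPair≡createsPattern a w)

avoidsBoth : List ℕ → Bool
avoidsBoth σ = avoids σ p112 ∧ avoids σ p221

avoidsBoth-∷ : ∀ a w → avoidsBoth (a ∷ w) ≡ avoidsBoth w ∧ not (createsPattern a w)
avoidsBoth-∷ a w = begin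
  not (contains (a ∷ w) p112) ∧ not (contains (a ∷ w) p221)
    ≡⟨ cong₂ (λ x y → not x ∧ not y) (any-subseqs-∷ (λ s → orderIso s p112) a w)
                                      (any-subseqs-∷ (λ s → orderIso s p221) a w) ⟩
  not (startsWith p112 ∨ contains w p112) ∧ not (startsWith p221 ∨ contains w p221)
    ≡⟨ not-∨-interchange (startsWith p112) (startsWith p221) (contains w p112) (contains w p221) ⟩
  avoidsBoth w ∧ not (startsWith p112 ∨ startsWith p221)
    ≡⟨ cong (λ x → avoidsBoth w ∧ not x) startsWith-112-221 ⟩
  avoidsBoth w ∧ not (createsPattern a w)
    ∎
  where
  open ≡-Reasoning
  startsWith : List ℕ → Bool
  startsWith τ = any (λ s → orderIso (a ∷ s) τ) (subseqs w)

  startsWith-3 : ∀ x y z →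
                 startsWith (x ∷ y ∷ z ∷ []) ≡ anyPair (λ b c → orderIso (a ∷ b ∷ c ∷ []) (x ∷ y ∷ z ∷ [])) w
  startsWith-3 x y z = trans (any-cong (orderIso-∷-length3 a) (subseqs w)) (any-subseqs-isPair _ w)

  startsWith-112-221 : startsWith p112 ∨ startsWith p221 ≡ createsPattern a w
  startsWith-112-221 = begin
    startsWith p112 ∨ startsWith p221
      ≡⟨ cong₂ _∨_ (startsWith-3 1 1 2) (startsWith-3 2 2 1) ⟩
    anyPair (λ b c → orderIso (a ∷ b ∷ c ∷ []) p112) w ∨ anyPair (λ b c → orderIso (a ∷ b ∷ c ∷ []) p221) w
      ≡⟨ anyPair-∨ _ _ w ⟩
    anyPair (head-112-221 a) w
      ≡⟨ anyPair-cong (head-112-221≡ a) w ⟩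
    anyPair (λ b c → (a ≡ᵇ b) ∧ not (a ≡ᵇ c)) w
      ≡⟨ anyPair≡createsPattern a w ⟩
    createsPattern a w
      ∎

  not-∨-interchange : ∀ x y u v → not (x ∨ u) ∧ not (y ∨ v) ≡ (not u ∧ not v) ∧ not (x ∨ y)
  not-∨-interchange true  y     u     v     = sym (∧-zeroʳ _)
  not-∨-interchange false true  u     v     = trans (∧-zeroʳ (not u)) (sym (∧-zeroʳ _))
  not-∨-interchange false false u     v     = sym (∧-identityʳ _)

-- Distinct letters and the last letter

occurs : ℕ → List ℕ → Bool
occurs a []      = false
occurs a (b ∷ w) = (a ≡ᵇ b) ∨ occurs a w

nDistinct : List ℕ → ℕ
nDistinct []      = 0
nDistinct (b ∷ w) = if occurs b w then nDistinct w else suc (nDistinct w)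

lastOf : ℕ → List ℕ → ℕ
lastOf x []       = x
lastOf x (y ∷ ys) = lastOf y ys

lastRepeatable : List ℕ → Bool
lastRepeatable []       = true
lastRepeatable (x ∷ xs) = not (createsPattern (lastOf x xs) (x ∷ xs))

occurs-≡ᵇ : ∀ {a b} w → (a ≡ᵇ b) ≡ true → occurs a w ≡ occurs b w
occurs-≡ᵇ {a} {b} w a≡ᵇb = cong (λ c → occurs c w) (≡ᵇ-sound a b a≡ᵇb)

occurs-∷-≢ : ∀ {a c} w → (a ≡ᵇ c) ≡ false → occurs a (c ∷ w) ≡ true → occurs a w ≡ true
occurs-∷-≢ {a} w a≢c a∈cw = subst (λ t → t ∨ occurs a w ≡ true) a≢c a∈cw

occurs-∷-tail : ∀ {a c} w → occurs c w ≡ true → occurs a (c ∷ w) ≡ true → occurs a w ≡ true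
occurs-∷-tail {a} {c} w c∈w a∈cw with a ≡ᵇ c in a≡ᵇc
... | true  = trans (occurs-≡ᵇ w a≡ᵇc) c∈w
... | false = a∈cw

occurs-head : ∀ b w → occurs b (b ∷ w) ≡ true
occurs-head b w rewrite ≡ᵇ-refl b = refl

occurs-lastOf : ∀ x xs → occurs (lastOf x xs) (x ∷ xs) ≡ true
occurs-lastOf x []       rewrite ≡ᵇ-refl x = refl
occurs-lastOf x (y ∷ ys) rewrite occurs-lastOf y ys = ∨-zeroʳ _

fresh≢lastOf : ∀ {a} x xs → occurs a (x ∷ xs) ≡ false → a ≢ lastOf x xs
fresh≢lastOf x xs a∉w refl = case trans (sym (occurs-lastOf x xs)) a∉w of λ ()

lastOf-All : ∀ {P : ℕ → Set} x xs → All P (x ∷ xs) → P (lastOf x xs)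
lastOf-All x []       (px ∷ _)  = px
lastOf-All x (y ∷ ys) (_  ∷ ps) = lastOf-All y ys ps

createsPattern-fresh : ∀ {a} w → occurs a w ≡ false → createsPattern a w ≡ false
createsPattern-fresh []      _    = refl
createsPattern-fresh {a} (b ∷ w) a∉bw
  rewrite ∨-conicalˡ (a ≡ᵇ b) _ a∉bw = createsPattern-fresh w (∨-conicalʳ (a ≡ᵇ b) _ a∉bw)

nDistinct-∷-pos : ∀ b w → 1 ≤ nDistinct (b ∷ w)
nDistinct-∷-pos b w with occurs b w in b∈w
nDistinct-∷-pos b []      | true  = case b∈w of λ ()
nDistinct-∷-pos b (c ∷ w) | true  = nDistinct-∷-pos c w
...                       | false = s≤s z≤n

occurs⇒nDistinct-pos : ∀ {a} w → occurs a w ≡ true → 1 ≤ nDistinct w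
occurs⇒nDistinct-pos (b ∷ w) _ = nDistinct-∷-pos b w

nDistinct-two : ∀ {a b} w → occurs a w ≡ true → occurs b w ≡ true → a ≢ b → 2 ≤ nDistinct w
nDistinct-two {a} {b} (c ∷ w) a∈cw b∈cw a≢b with occurs c w in c∈w
... | true  = nDistinct-two w (occurs-∷-tail w c∈w a∈cw) (occurs-∷-tail w c∈w b∈cw) a≢b
... | false with a ≟ c
...   | yes refl = s≤s (occurs⇒nDistinct-pos w (occurs-∷-≢ w (≢⇒≡ᵇ-false (a≢b ∘ sym)) b∈cw))
...   | no a≢c   = s≤s (occurs⇒nDistinct-pos w (occurs-∷-≢ w (≢⇒≡ᵇ-false a≢c) a∈cw))

noOtherLetter-fresh : ∀ {a} w → occurs a w ≡ false → not (any (λ c → not (a ≡ᵇ c)) w) ≡ (nDistinct w ≡ᵇ 0)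
noOtherLetter-fresh     []      _    = refl
noOtherLetter-fresh {a} (b ∷ w) a∉bw
  rewrite ∨-conicalˡ (a ≡ᵇ b) _ a∉bw = sym (≡ᵇ0-pos (nDistinct-∷-pos b w))

noOtherLetter : ∀ {a} w → occurs a w ≡ true → not (any (λ c → not (a ≡ᵇ c)) w) ≡ (nDistinct w ≡ᵇ 1)
noOtherLetter {a} (b ∷ w) a∈bw with a ≟ b
... | no a≢b = trans (cong (λ t → not (not t ∨ any (λ c → not (a ≡ᵇ c)) w)) (≢⇒≡ᵇ-false a≢b))
                     (sym (≡ᵇ1-two (nDistinct-two (b ∷ w) a∈bw (occurs-head b w) a≢b)))
... | yes refl rewrite ≡ᵇ-refl a with occurs a w in a∈w
...   | true  = noOtherLetter w a∈w
...   | false = noOtherLetter-fresh w a∈w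

notCreating⇒lastOf : ∀ {a} x xs → occurs a (x ∷ xs) ≡ true → createsPattern a (x ∷ xs) ≡ false → a ≡ lastOf x xs
notCreating⇒lastOf {a} x []       a∈x  _ = ≡ᵇ-sound a x (trans (sym (∨-identityʳ (a ≡ᵇ x))) a∈x)
notCreating⇒lastOf {a} x (y ∷ ys) a∈xw ¬cp with occurs a (y ∷ ys) in a∈w
... | true  = notCreating⇒lastOf y ys a∈w (∨-conicalʳ ((a ≡ᵇ x) ∧ _) _ ¬cp)
... | false = case trans (sym xThenY) (∨-conicalˡ _ _ ¬cp) of λ ()
  where
  xThenY : (a ≡ᵇ x) ∧ any (λ c → not (a ≡ᵇ c)) (y ∷ ys) ≡ true
  xThenY rewrite trans (sym (∨-identityʳ (a ≡ᵇ x))) a∈xw | ∨-conicalˡ (a ≡ᵇ y) _ a∈w = refl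

lastRepeatable-fresh : ∀ {a} w → occurs a w ≡ false → lastRepeatable (a ∷ w) ≡ lastRepeatable w
lastRepeatable-fresh {a} []       _   rewrite ≡ᵇ-refl a = refl
lastRepeatable-fresh {a} (x ∷ xs) a∉w rewrite ≢⇒≡ᵇ-false (fresh≢lastOf x xs a∉w ∘ sym) = refl

sumTo : ℕ → (ℕ → ℕ) → ℕ
sumTo zero    h = 0
sumTo (suc k) h = sumTo k h + h (suc k)

sumTo-cong : ∀ k {f g} → (∀ a → f (suc a) ≡ g (suc a)) → sumTo k f ≡ sumTo k g
sumTo-cong zero    f≗g = refl
sumTo-cong (suc k) f≗g = cong₂ _+_ (sumTo-cong k f≗g) (f≗g k)

sumTo-+ : ∀ k f g → sumTo k (λ a → f a + g a) ≡ sumTo k f + sumTo k g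
sumTo-+ zero    f g = refl
sumTo-+ (suc k) f g = trans (cong (_+ (f (suc k) + g (suc k))) (sumTo-+ k f g))
                            (+-Properties.interchange (sumTo k f) (sumTo k g) (f (suc k)) (g (suc k)))

sumTo-const : ∀ k v → sumTo k (λ _ → v) ≡ k * v
sumTo-const zero    v = refl
sumTo-const (suc k) v = trans (cong (_+ v) (sumTo-const k v)) (+-comm (k * v) v)

sumTo-if : ∀ k b f → sumTo k (λ a → if b then f a else 0) ≡ (if b then sumTo k f else 0)
sumTo-if k true  f = refl
sumTo-if k false f = trans (sumTo-const k 0) (*-zeroʳ k)

sumTo-≡ᵇ-beyond : ∀ k {b} v → k < b → sumTo k (λ a → if a ≡ᵇ b then v else 0) ≡ 0
sumTo-≡ᵇ-beyond zero    v _   = refl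
sumTo-≡ᵇ-beyond (suc k) v k<b
  rewrite sumTo-≡ᵇ-beyond k v (<-trans (n<1+n k) k<b) | ≢⇒≡ᵇ-false (<⇒≢ k<b) = refl

sumTo-≡ᵇ : ∀ k {b} v → 1 ≤ b → b ≤ k → sumTo k (λ a → if a ≡ᵇ b then v else 0) ≡ v
sumTo-≡ᵇ zero    v (s≤s _) ()
sumTo-≡ᵇ (suc k) {b} v 1≤b b≤1+k with m≤n⇒m<n∨m≡n b≤1+k
... | inj₁ (s≤s b≤k) rewrite sumTo-≡ᵇ k v 1≤b b≤k | ≢⇒≡ᵇ-false (<⇒≢ (s≤s b≤k) ∘ sym) = +-identityʳ v
... | inj₂ refl      rewrite sumTo-≡ᵇ-beyond k v (n<1+n k) | ≡ᵇ-refl k = refl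

sumTo-stable : ∀ {h k} m → (∀ d → k < d → h d ≡ 0) → k ≤ m → sumTo m h ≡ sumTo k h
sumTo-stable zero    vanish z≤n = refl
sumTo-stable {h} (suc m) vanish k≤1+m with m≤n⇒m<n∨m≡n k≤1+m
... | inj₂ refl      = refl
... | inj₁ (s≤s k≤m) = trans (cong (sumTo m h +_) (vanish (suc m) (s≤s k≤m)))
                             (trans (+-identityʳ (sumTo m h)) (sumTo-stable m vanish k≤m))

sum-letters≡sumTo : ∀ k h → sum (map h (letters k)) ≡ sumTo k h
sum-letters≡sumTo zero    h = refl
sum-letters≡sumTo (suc k) h = begin
  sum (map h (map suc (upTo (suc k))))
    ≡⟨ cong (sum ∘ map h ∘ map suc) (sym (upTo-∷ʳ k)) ⟩
  sum (map h (map suc (upTo k ++ k ∷ [])))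
    ≡⟨ cong (sum ∘ map h) (map-++ suc (upTo k) (k ∷ [])) ⟩
  sum (map h (letters k ++ suc k ∷ []))
    ≡⟨ cong sum (map-++ h (letters k) (suc k ∷ [])) ⟩
  sum (map h (letters k) ++ h (suc k) ∷ [])
    ≡⟨ sum-++ (map h (letters k)) (h (suc k) ∷ []) ⟩
  sum (map h (letters k)) + (h (suc k) + 0)
    ≡⟨ cong₂ _+_ (sum-letters≡sumTo k h) (+-identityʳ (h (suc k))) ⟩
  sumTo k h + h (suc k)
    ∎
  where open ≡-Reasoning

InAlphabet : ℕ → ℕ → Set
InAlphabet k b = 1 ≤ b × b ≤ k

sumTo-occurs : ∀ k v w → All (InAlphabet k) w → sumTo k (λ a → if occurs a w then v else 0) ≡ nDistinct w * v
sumTo-occurs k v []      []                         = trans (sumTo-const k 0) (*-zeroʳ k)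
sumTo-occurs k v (b ∷ w) ((1≤b , b≤k) ∷ w-inAlph) = byOccurrence (occurs b w) refl
  where
  open ≡-Reasoning
  byOccurrence : ∀ t → occurs b w ≡ t →
                 sumTo k (λ a → if occurs a (b ∷ w) then v else 0) ≡ (if t then nDistinct w else suc (nDistinct w)) * v
  byOccurrence true b∈w = trans (sumTo-cong k (pointwise ∘ suc)) (sumTo-occurs k v w w-inAlph)
    where
    pointwise : ∀ a → (if (a ≡ᵇ b) ∨ occurs a w then v else 0) ≡ (if occurs a w then v else 0)
    pointwise a with a ≡ᵇ b in a≡ᵇb
    ... | true  = cong (λ t → if t then v else 0) (sym (trans (occurs-≡ᵇ w a≡ᵇb) b∈w))
    ... | false = refl
  byOccurrence false b∉w = begin
    sumTo k (λ a → if (a ≡ᵇ b) ∨ occurs a w then v else 0)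
      ≡⟨ sumTo-cong k (pointwise ∘ suc) ⟩
    sumTo k (λ a → (if a ≡ᵇ b then v else 0) + (if occurs a w then v else 0))
      ≡⟨ sumTo-+ k _ _ ⟩
    sumTo k (λ a → if a ≡ᵇ b then v else 0) + sumTo k (λ a → if occurs a w then v else 0)
      ≡⟨ cong₂ _+_ (sumTo-≡ᵇ k v 1≤b b≤k) (sumTo-occurs k v w w-inAlph) ⟩
    v + nDistinct w * v
      ∎
    where
    pointwise : ∀ a → (if (a ≡ᵇ b) ∨ occurs a w then v else 0)
                    ≡ (if a ≡ᵇ b then v else 0) + (if occurs a w then v else 0)
    pointwise a with a ≡ᵇ b in a≡ᵇb
    ... | true  = sym (trans (cong (λ t → v + (if t then v else 0)) (trans (occurs-≡ᵇ w a≡ᵇb) b∉w)) (+-identityʳ v))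
    ... | false = refl

sumTo-fresh : ∀ k v w → All (InAlphabet k) w → sumTo k (λ a → if occurs a w then 0 else v) ≡ (k ∸ nDistinct w) * v
sumTo-fresh k v w w-inAlph = begin
  sumTo k (λ a → if occurs a w then 0 else v)
    ≡⟨ sym (m+n∸n≡m _ (nDistinct w * v)) ⟩
  sumTo k (λ a → if occurs a w then 0 else v) + nDistinct w * v ∸ nDistinct w * v
    ≡⟨ cong (_∸ nDistinct w * v) complement ⟩
  k * v ∸ nDistinct w * v
    ≡⟨ sym (*-distribʳ-∸ v k (nDistinct w)) ⟩
  (k ∸ nDistinct w) * v
    ∎
  where
  open ≡-Reasoning
  fresh+occurring : ∀ b → (if b then 0 else v) + (if b then v else 0) ≡ v
  fresh+occurring true  = refl
  fresh+occurring false = +-identityʳ v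
  complement : sumTo k (λ a → if occurs a w then 0 else v) + nDistinct w * v ≡ k * v
  complement = begin
    sumTo k (λ a → if occurs a w then 0 else v) + nDistinct w * v
      ≡⟨ cong (sumTo k (λ a → if occurs a w then 0 else v) +_) (sym (sumTo-occurs k v w w-inAlph)) ⟩
    sumTo k (λ a → if occurs a w then 0 else v) + sumTo k (λ a → if occurs a w then v else 0)
      ≡⟨ sym (sumTo-+ k _ _) ⟩
    sumTo k (λ a → (if occurs a w then 0 else v) + (if occurs a w then v else 0))
      ≡⟨ sumTo-cong k (λ a → fresh+occurring (occurs (suc a) w)) ⟩
    sumTo k (λ _ → v)
      ≡⟨ sumTo-const k v ⟩
    k * v
      ∎

-- Prepending a letter

-- A function of the state (d, c) of a word.
Weight : Set
Weight = ℕ → Bool → ℕ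

contribution : Weight → List ℕ → ℕ → ℕ
contribution φ w a = if not (createsPattern a w) then φ (nDistinct (a ∷ w)) (lastRepeatable (a ∷ w)) else 0

repeatContribution : Weight → List ℕ → ℕ → ℕ
repeatContribution φ []       a = 0
repeatContribution φ (x ∷ xs) a =
  if lastRepeatable (x ∷ xs) ∧ (a ≡ᵇ lastOf x xs) then φ (nDistinct (x ∷ xs)) (nDistinct (x ∷ xs) ≡ᵇ 1) else 0

contribution-fresh : ∀ φ {a} w → occurs a w ≡ false →
                     contribution φ w a ≡ φ (suc (nDistinct w)) (lastRepeatable w)
contribution-fresh φ w a∉w rewrite createsPattern-fresh w a∉w | a∉w | lastRepeatable-fresh w a∉w = refl

repeatContribution-fresh : ∀ φ {a} w → occurs a w ≡ false → repeatContribution φ w a ≡ 0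
repeatContribution-fresh φ []       _   = refl
repeatContribution-fresh φ (x ∷ xs) a∉w
  rewrite ≢⇒≡ᵇ-false (fresh≢lastOf x xs a∉w) | ∧-zeroʳ (lastRepeatable (x ∷ xs)) = refl

contribution-repeat : ∀ φ {a} x xs → occurs a (x ∷ xs) ≡ true →
                      contribution φ (x ∷ xs) a ≡ repeatContribution φ (x ∷ xs) a
contribution-repeat φ {a} x xs a∈w with createsPattern a (x ∷ xs) in cp
... | true with a ≟ lastOf x xs
...   | yes refl rewrite cp = refl
...   | no a≢L   rewrite ≢⇒≡ᵇ-false a≢L | ∧-zeroʳ (lastRepeatable (x ∷ xs)) = refl
contribution-repeat φ {a} x xs a∈w | false with notCreating⇒lastOf x xs a∈w cp
...   | refl rewrite cp | ≡ᵇ-refl a | a∈w =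
  cong (φ (nDistinct (x ∷ xs))) (trans (cong not (∨-identityʳ _)) (noOtherLetter (x ∷ xs) a∈w))

contribution-split : ∀ φ w a → contribution φ w a ≡
  (if occurs a w then 0 else φ (suc (nDistinct w)) (lastRepeatable w)) + repeatContribution φ w a
contribution-split φ w a = byOccurrence w (occurs a w) refl
  where
  byOccurrence : ∀ w b → occurs a w ≡ b → contribution φ w a ≡
    (if b then 0 else φ (suc (nDistinct w)) (lastRepeatable w)) + repeatContribution φ w a
  byOccurrence (x ∷ xs) true  a∈w = contribution-repeat φ x xs a∈w
  byOccurrence w        false a∉w = trans (contribution-fresh φ w a∉w)
    (sym (trans (cong (_ +_) (repeatContribution-fresh φ w a∉w)) (+-identityʳ _)))

repeatStep : Weight → Weight
repeatStep φ zero    c = 0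
repeatStep φ (suc d) c = if c then φ (suc d) (suc d ≡ᵇ 1) else 0

step : ℕ → Weight → Weight
step k φ d c = (k ∸ d) * φ (suc d) c + repeatStep φ d c

sumTo-repeatContribution : ∀ k φ w → All (InAlphabet k) w →
                           sumTo k (repeatContribution φ w) ≡ repeatStep φ (nDistinct w) (lastRepeatable w)
sumTo-repeatContribution k φ []       []       = trans (sumTo-const k 0) (*-zeroʳ k)
sumTo-repeatContribution k φ (x ∷ xs) w-inAlph = begin
  sumTo k (λ a → if c ∧ (a ≡ᵇ L) then φ d (d ≡ᵇ 1) else 0)
    ≡⟨ sumTo-cong k (λ a → if-∧ c) ⟩
  sumTo k (λ a → if c then (if a ≡ᵇ L then φ d (d ≡ᵇ 1) else 0) else 0)
    ≡⟨ sumTo-if k c _ ⟩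
  (if c then sumTo k (λ a → if a ≡ᵇ L then φ d (d ≡ᵇ 1) else 0) else 0)
    ≡⟨ cong (λ s → if c then s else 0) (sumTo-≡ᵇ k _ 1≤L L≤k) ⟩
  (if c then φ d (d ≡ᵇ 1) else 0)
    ≡⟨ repeatStep-pos (nDistinct-∷-pos x xs) ⟩
  repeatStep φ d c
    ∎
  where
  open ≡-Reasoning
  c = lastRepeatable (x ∷ xs)
  d = nDistinct (x ∷ xs)
  L = lastOf x xs
  1≤L : 1 ≤ L
  1≤L = proj₁ (lastOf-All x xs w-inAlph)
  L≤k : L ≤ k
  L≤k = proj₂ (lastOf-All x xs w-inAlph)
  repeatStep-pos : ∀ {d} → 1 ≤ d → (if c then φ d (d ≡ᵇ 1) else 0) ≡ repeatStep φ d c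
  repeatStep-pos (s≤s _) = refl

sumTo-contribution : ∀ k φ w → All (InAlphabet k) w →
                     sumTo k (contribution φ w) ≡ step k φ (nDistinct w) (lastRepeatable w)
sumTo-contribution k φ w w-inAlph = begin
  sumTo k (contribution φ w)
    ≡⟨ sumTo-cong k (contribution-split φ w ∘ suc) ⟩
  sumTo k (λ a → (if occurs a w then 0 else φ (suc (nDistinct w)) (lastRepeatable w)) + repeatContribution φ w a)
    ≡⟨ sumTo-+ k _ _ ⟩
  sumTo k (λ a → if occurs a w then 0 else φ (suc (nDistinct w)) (lastRepeatable w)) + sumTo k (repeatContribution φ w)
    ≡⟨ cong₂ _+_ (sumTo-fresh k _ w w-inAlph) (sumTo-repeatContribution k φ w w-inAlph) ⟩
  step k φ (nDistinct w) (lastRepeatable w)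
    ∎
  where open ≡-Reasoning

-- Summing over all words

sum-concatMap : ∀ {A B : Set} (h : B → ℕ) (f : A → List B) xs →
                sum (map h (concatMap f xs)) ≡ sum (map (λ x → sum (map h (f x))) xs)
sum-concatMap h f []       = refl
sum-concatMap h f (x ∷ xs) = begin
  sum (map h (f x ++ concatMap f xs))
    ≡⟨ cong sum (map-++ h (f x) (concatMap f xs)) ⟩
  sum (map h (f x) ++ map h (concatMap f xs))
    ≡⟨ sum-++ (map h (f x)) (map h (concatMap f xs)) ⟩
  sum (map h (f x)) + sum (map h (concatMap f xs))
    ≡⟨ cong (sum (map h (f x)) +_) (sum-concatMap h f xs) ⟩
  sum (map h (f x)) + sum (map (λ x → sum (map h (f x))) xs)
    ∎
  where open ≡-Reasoning

length-filterᵇ : ∀ {A : Set} (p : A → Bool) xs → length (filterᵇ p xs) ≡ sum (map (λ x → if p x then 1 else 0) xs)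
length-filterᵇ p []       = refl
length-filterᵇ p (x ∷ xs) with p x
... | true  = cong suc (length-filterᵇ p xs)
... | false = length-filterᵇ p xs

letters-inAlphabet : ∀ k → All (InAlphabet k) (letters k)
letters-inAlphabet k = All.map⁺ (All.applyUpTo⁺₁ (λ i → i) k (λ i<k → s≤s z≤n , i<k))

words-inAlphabet : ∀ n k → All (All (InAlphabet k)) (words n k)
words-inAlphabet zero    k = [] ∷ []
words-inAlphabet (suc n) k = All.concat⁺ (All.map⁺ (All.map extend (words-inAlphabet n k)))
  where
  extend : ∀ {w} → All (InAlphabet k) w → All (All (InAlphabet k)) (map (_∷ w) (letters k))
  extend w-inAlph = All.map⁺ (All.map (_∷ w-inAlph) (letters-inAlphabet k))

weighted : Weight → List ℕ → ℕ
weighted φ w = if avoidsBoth w then φ (nDistinct w) (lastRepeatable w) else 0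

weightedCount : ℕ → ℕ → Weight → ℕ
weightedCount k n φ = sum (map (weighted φ) (words n k))

weightedCount-suc : ∀ k n φ → weightedCount k (suc n) φ ≡ weightedCount k n (step k φ)
weightedCount-suc k n φ = begin
  sum (map (weighted φ) (concatMap (λ w → map (_∷ w) (letters k)) (words n k)))
    ≡⟨ sum-concatMap (weighted φ) _ (words n k) ⟩
  sum (map (λ w → sum (map (weighted φ) (map (_∷ w) (letters k)))) (words n k))
    ≡⟨ cong sum (map-cong-local (All.map (λ {w} → extensions w) (words-inAlphabet n k))) ⟩
  sum (map (weighted (step k φ)) (words n k))
    ∎
  where
  open ≡-Reasoning
  weighted-∷ : ∀ w a → weighted φ (a ∷ w) ≡ (if avoidsBoth w then contribution φ w a else 0)
  weighted-∷ w a = trans (cong (λ t → if t then φ (nDistinct (a ∷ w)) (lastRepeatable (a ∷ w)) else 0) (avoidsBoth-∷ a w))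
                         (if-∧ (avoidsBoth w))

  extensions : ∀ w → All (InAlphabet k) w → sum (map (weighted φ) (map (_∷ w) (letters k))) ≡ weighted (step k φ) w
  extensions w w-inAlph = begin
    sum (map (weighted φ) (map (_∷ w) (letters k)))
      ≡⟨ cong sum (sym (map-∘ (letters k))) ⟩
    sum (map (λ a → weighted φ (a ∷ w)) (letters k))
      ≡⟨ sum-letters≡sumTo k _ ⟩
    sumTo k (λ a → weighted φ (a ∷ w))
      ≡⟨ sumTo-cong k (weighted-∷ w ∘ suc) ⟩
    sumTo k (λ a → if avoidsBoth w then contribution φ w a else 0)
      ≡⟨ sumTo-if k (avoidsBoth w) (contribution φ w) ⟩
    (if avoidsBoth w then sumTo k (contribution φ w) else 0)
      ≡⟨ cong (λ s → if avoidsBoth w then s else 0) (sumTo-contribution k φ w w-inAlph) ⟩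
    weighted (step k φ) w
      ∎

f112-221≡weightedCount : ∀ n k → f112-221 n k ≡ weightedCount k n (λ _ _ → 1)
f112-221≡weightedCount n k = length-filterᵇ avoidsBoth (words n k)

closedForm : ℕ → ℕ → Weight → ℕ
closedForm k m φ = sumTo (suc m) (λ d → (k P′ d) * φ d true) + sumTo m (λ d → (k P′ d) * (d ∸ 1) * φ d false)

closedForm-suc : ∀ k m φ → closedForm k (suc m) φ ≡
  closedForm k m φ + ((k P′ suc (suc m)) * φ (suc (suc m)) true + (k P′ suc m) * m * φ (suc m) false)
closedForm-suc k m φ = +-Properties.interchange
  (sumTo (suc m) (λ d → (k P′ d) * φ d true)) ((k P′ suc (suc m)) * φ (suc (suc m)) true)
  (sumTo m (λ d → (k P′ d) * (d ∸ 1) * φ d false)) ((k P′ suc m) * m * φ (suc m) false)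

closedForm-step : ∀ k m φ → closedForm k m (step k φ) ≡ closedForm k (suc m) φ
closedForm-step k zero    φ =
  solve 5 (λ p a x y z → (con 0 :+ p :* (a :* x :+ y)) :+ con 0
                       := ((con 0 :+ p :* y) :+ a :* p :* x) :+ (con 0 :+ p :* con 0 :* z))
        refl (k P′ 1) (k ∸ 1) (φ 2 true) (φ 1 true) (φ 1 false)
closedForm-step k (suc m) φ = begin
  closedForm k (suc m) (step k φ)
    ≡⟨ closedForm-suc k m (step k φ) ⟩
  closedForm k m (step k φ) + ((k P′ suc (suc m)) * step k φ (suc (suc m)) true + (k P′ suc m) * m * step k φ (suc m) false)
    ≡⟨ cong₂ _+_ (closedForm-step k m φ) newTerms ⟩
  closedForm k (suc m) φ
    + ((k P′ suc (suc (suc m))) * φ (suc (suc (suc m))) true + (k P′ suc (suc m)) * suc m * φ (suc (suc m)) false)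
    ≡⟨ sym (closedForm-suc k (suc m) φ) ⟩
  closedForm k (suc (suc m)) φ
    ∎
  where
  open ≡-Reasoning
  newTerms : (k P′ suc (suc m)) * step k φ (suc (suc m)) true + (k P′ suc m) * m * step k φ (suc m) false
           ≡ (k P′ suc (suc (suc m))) * φ (suc (suc (suc m))) true + (k P′ suc (suc m)) * suc m * φ (suc (suc m)) false
  newTerms = solve 6 (λ p a b x y n → b :* p :* (a :* x :+ y) :+ p :* n :* (b :* y :+ con 0)
                                    := a :* (b :* p) :* x :+ b :* p :* (con 1 :+ n) :* y)
                     refl (k P′ suc m) (k ∸ suc (suc m)) (k ∸ suc m) (φ (suc (suc (suc m))) true) (φ (suc (suc m)) false) m

weightedCount≡closedForm : ∀ k m φ → weightedCount k (suc m) φ ≡ closedForm k m φ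
weightedCount≡closedForm k zero    φ = trans (weightedCount-suc k 0 φ)
  (solve 2 (λ k x → (k :* x :+ con 0) :+ con 0 := (con 0 :+ k :* con 1 :* x) :+ con 0) refl k (φ 1 true))
weightedCount≡closedForm k (suc m) φ = begin
  weightedCount k (suc (suc m)) φ   ≡⟨ weightedCount-suc k (suc m) φ ⟩
  weightedCount k (suc m) (step k φ) ≡⟨ weightedCount≡closedForm k m (step k φ) ⟩
  closedForm k m (step k φ)         ≡⟨ closedForm-step k m φ ⟩
  closedForm k (suc m) φ            ∎
  where open ≡-Reasoning

f112-221-suc : ∀ m k → f112-221 (suc m) k ≡ (k P′ suc m) + sumTo m (λ d → d * (k P′ d))
f112-221-suc m k = begin
  f112-221 (suc m) k
    ≡⟨ f112-221≡weightedCount (suc m) k ⟩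
  weightedCount k (suc m) (λ _ _ → 1)
    ≡⟨ weightedCount≡closedForm k m (λ _ _ → 1) ⟩
  (sumTo m (λ d → (k P′ d) * 1) + (k P′ suc m) * 1) + sumTo m (λ d → (k P′ d) * (d ∸ 1) * 1)
    ≡⟨ solve 3 (λ s p t → (s :+ p :* con 1) :+ t := p :+ (s :+ t)) refl
               (sumTo m (λ d → (k P′ d) * 1)) (k P′ suc m) (sumTo m (λ d → (k P′ d) * (d ∸ 1) * 1)) ⟩
  (k P′ suc m) + (sumTo m (λ d → (k P′ d) * 1) + sumTo m (λ d → (k P′ d) * (d ∸ 1) * 1))
    ≡⟨ cong ((k P′ suc m) +_) (trans (sym (sumTo-+ m _ _)) (sumTo-cong m count)) ⟩
  (k P′ suc m) + sumTo m (λ d → d * (k P′ d))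
    ∎
  where
  open ≡-Reasoning
  count : ∀ d → (k P′ suc d) * 1 + (k P′ suc d) * d * 1 ≡ suc d * (k P′ suc d)
  count d = solve 2 (λ p d → p :* con 1 :+ p :* d :* con 1 := (con 1 :+ d) :* p) refl (k P′ suc d) d

-- Falling factorials

P′-vanish : ∀ {n k} → n < k → n P′ k ≡ 0
P′-vanish {n} {suc k} (s≤s n≤k) with m≤n⇒m<n∨m≡n n≤k
... | inj₁ n<k  = trans (cong ((n ∸ k) *_) (P′-vanish n<k)) (*-zeroʳ (n ∸ k))
... | inj₂ refl = cong (_* (n P′ n)) (n∸n≡0 n)

suc-P′-suc : ∀ n k → suc n P′ suc k ≡ suc n * (n P′ k)
suc-P′-suc n zero    = refl
suc-P′-suc n (suc k) = trans (cong ((n ∸ k) *_) (suc-P′-suc n k)) (*-Properties.x∙yz≈y∙xz (n ∸ k) (suc n) (n P′ k))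

!*C≡P′ : ∀ n k → k ! * (n C k) ≡ n P′ k
!*C≡P′ n       zero    = refl
!*C≡P′ zero    (suc k) = trans (*-zeroʳ (suc k !)) (sym (cong (_* (0 P′ k)) (0∸n≡0 k)))
!*C≡P′ (suc n) (suc k) = begin
  suc k ! * (suc n C suc k)
    ≡⟨ cong (suc k ! *_) (sym (nCk+nC[k+1]≡[n+1]C[k+1] n k)) ⟩
  suc k ! * (n C k + n C suc k)
    ≡⟨ *-distribˡ-+ (suc k !) (n C k) (n C suc k) ⟩
  suc k ! * (n C k) + suc k ! * (n C suc k)
    ≡⟨ cong (_+ suc k ! * (n C suc k)) (*-assoc (suc k) (k !) (n C k)) ⟩
  suc k * (k ! * (n C k)) + suc k ! * (n C suc k)
    ≡⟨ cong₂ (λ x y → suc k * x + y) (!*C≡P′ n k) (!*C≡P′ n (suc k)) ⟩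
  suc k * (n P′ k) + (n ∸ k) * (n P′ k)
    ≡⟨ sym (*-distribʳ-+ (n P′ k) (suc k) (n ∸ k)) ⟩
  (suc k + (n ∸ k)) * (n P′ k)
    ≡⟨ pascal-weight ⟩
  suc n * (n P′ k)
    ≡⟨ sym (suc-P′-suc n k) ⟩
  suc n P′ suc k
    ∎
  where
  open ≡-Reasoning
  pascal-weight : (suc k + (n ∸ k)) * (n P′ k) ≡ suc n * (n P′ k)
  pascal-weight with k ≤? n
  ... | yes k≤n = cong (λ t → suc t * (n P′ k)) (m+[n∸m]≡n k≤n)
  ... | no  k≰n rewrite P′-vanish (≰⇒> k≰n) = trans (*-zeroʳ (suc k + (n ∸ k))) (sym (*-zeroʳ (suc n)))

S≡sumTo : ∀ m k → S m k ≡ sumTo m (λ d → d * (k P′ d))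
S≡sumTo m k = trans (sum-letters≡sumTo m _)
  (sumTo-cong m (λ j → trans (*-assoc (suc j) (suc j !) (k C suc j)) (cong (suc j *_) (!*C≡P′ k (suc j)))))

theorem9 : ((k n : ℕ) → suc k ≤ n → f112-221 n k ≡ S k k)
         × ((k n : ℕ) → 2 ≤ n → n ≤ k → f112-221 n k ≡ n ! * (k C n) + S (n ∸ 1) k)
         × ((k : ℕ) → f112-221 0 k ≡ 1)
         × ((k : ℕ) → f112-221 1 k ≡ k)
theorem9 = beyondAlphabet , withinAlphabet , (λ _ → refl) , singleLetter
  where
  open ≡-Reasoning
  beyondAlphabet : (k n : ℕ) → suc k ≤ n → f112-221 n k ≡ S k k
  beyondAlphabet k (suc m) (s≤s k≤m) = begin
    f112-221 (suc m) k
      ≡⟨ f112-221-suc m k ⟩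
    (k P′ suc m) + sumTo m (λ d → d * (k P′ d))
      ≡⟨ cong₂ _+_ (P′-vanish (s≤s k≤m)) (sumTo-stable m vanish k≤m) ⟩
    sumTo k (λ d → d * (k P′ d))
      ≡⟨ S≡sumTo k k ⟨
    S k k
      ∎
    where
    vanish : ∀ d → k < d → d * (k P′ d) ≡ 0
    vanish d k<d = trans (cong (d *_) (P′-vanish k<d)) (*-zeroʳ d)
  -- f112-221-suc holds for every n ≥ 1.
  withinAlphabet : (k n : ℕ) → 2 ≤ n → n ≤ k → f112-221 n k ≡ n ! * (k C n) + S (n ∸ 1) k
  withinAlphabet k (suc m) _ _ = trans (f112-221-suc m k) (sym (cong₂ _+_ (!*C≡P′ k (suc m)) (S≡sumTo m k)))
  singleLetter : (k : ℕ) → f112-221 1 k ≡ k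
  singleLetter k = trans (f112-221-suc 0 k) (trans (+-identityʳ (k * 1)) (*-identityʳ k))
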